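{- Let $\boldsymbol{\phi}=(\phi_i)_{i\ge0}$ and $y$ be indeterminates and work in $\mathbb{Z}[\boldsymbol{\phi},y]$. Define $P=(p_{ij})_{i,j\ge0}$ by $p_{ij}=0$ if $j=0$ or $j>i+1$, and $p_{ij}=\frac{i!}{(j-1)!}\phi_{i-j+1}$ if $1\le j\le i+1$; and $B_y$ by $(B_y)_{nk}=\binom{n}{k}y^{n-k}$. Let $\Delta=(\delta_{i+1,j})_{i,j\ge0}$. Then $$B_y^{ -1}PB_y=P(I+y\Delta^{\mathrm T}).$$
   Context: $I$ is the identity matrix; $B_y$ is unit-lower-triangular, hence invertible over $\mathbb{Z}[\boldsymbol{\phi},y]$. -}

module Defs where

open import Level using (Level)
open import Data.Nat as ℕ using (ℕ; zero; suc; _∸_; _!; _<ᵇ_; _≡ᵇ_)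
open import Data.Nat.Properties using (_!≢0)
open import Data.Nat.DivMod using (_/_)
open import Data.Nat.Combinatorics using (_C_)
open import Data.Bool using (if_then_else_)
open import Algebra.Bundles using (CommutativeRing)

-- Since ℤ[φ,y] is the free commutative ring on the indeterminates, an
-- identity holds in ℤ[φ,y] iff it holds in every commutative ring for
-- every choice of φ : ℕ → R and y : R.
module Mat {c ℓ : Level} (R : CommutativeRing c ℓ) where
  open CommutativeRing R

  Matrix : Set c
  Matrix = ℕ → ℕ → Carrier

  natMul : ℕ → Carrier → Carrier
  natMul zero    x = 0#
  natMul (suc n) x = x + natMul n x

  pow : Carrier → ℕ → Carrier
  pow x zero    = 1#
  pow x (suc n) = x * pow x n

  sumTo : ℕ → (ℕ → Carrier) → Carrier
  sumTo zero    f = 0#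
  sumTo (suc n) f = sumTo n f + f n

  δ : ℕ → ℕ → Carrier
  δ i j = if i ≡ᵇ j then 1# else 0#

  I : Matrix
  I = δ

  -- Product of infinite matrices A·B where row i of A vanishes beyond
  -- column (bound i ∸ 1); the sum Σ_k A i k B k j is then the finite sum
  -- over k < bound i.
  mulB : (ℕ → ℕ) → Matrix → Matrix → Matrix
  mulB bound A B i j = sumTo (bound i) (λ k → A i k * B k j)

  -- Lower-triangular (row i supported on columns ≤ i) times anything.
  _·L_ : Matrix → Matrix → Matrix
  _·L_ = mulB suc

  -- P-like matrices (row i supported on columns ≤ i+1) times anything.
  _·P_ : Matrix → Matrix → Matrix
  _·P_ = mulB (λ i → suc (suc i))

  LowerTriangular : Matrix → Set ℓ
  LowerTriangular A = ∀ i j → i ℕ.< j → A i j ≈ 0#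

  Pm : (ℕ → Carrier) → Matrix
  Pm φ i zero    = 0#
  Pm φ i (suc j') =
    if suc i <ᵇ suc j' then 0#
    else natMul (_/_ (i !) (j' !) {{j' !≢0}}) (φ (i ∸ j'))

  By : Carrier → Matrix
  By y n k = natMul (n C k) (pow y (n ∸ k))

  Δ : Matrix
  Δ i j = δ (suc i) j

  transpose : Matrix → Matrix
  transpose A i j = A j i

  _+M_ : Matrix → Matrix → Matrix
  (A +M B) i j = A i j + B i j

  scale : Carrier → Matrix → Matrix
  scale a A i j = a * A i j

  _≈M_ : Matrix → Matrix → Set ℓ
  A ≈M B = ∀ i j → A i j ≈ B i j

module Submission where

open import Defs
open import Level using (Level)
open import Data.Nat using (ℕ)
open import Algebra.Bundles using (CommutativeRing)

-- Write B = B_y, P = Pm φ and Q = P(I + yΔᵀ).  Since Binv is a left inverse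
-- of the lower-triangular matrix B, the theorem follows from the
-- intertwining relation  P·B = B·Q : then Binv·(P·B) = Binv·(B·Q) = Q.
--
-- Entrywise Q_{kj} = p_{kj} + y·p_{k,j+1}, so (B·Q)_{ij} = (B·P)_{ij} +
-- y·(B·P)_{i,j+1}.  Both (P·B)_{ij} and (B·P)_{i,a+1} are sums over m ≤ i of
-- "binomial terms"  c·binom(n,a)·φ_m·y^{n-a}  with c = i!/(i-m)!, namely
-- with n = i-m+1, a = j for P·B (after reversing the summation order) and
-- n = i-m for B·P (using binom(i,a+m)·(a+m)!/a! = i!/(i-m)!·binom(i-m,a)).
-- Pascal's rule binom(n+1,a+1) = binom(n,a) + binom(n,a+1) then splits each
-- term of P·B into the two corresponding terms of B·Q.

module FactorialIdentity where
  open import Data.Nat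
  open import Data.Nat.Properties
  open import Data.Nat.DivMod using (_/_; m/n*n≡m)
  open import Data.Nat.Divisibility using (∣-trans; m∣m*n)
  open import Data.Nat.Combinatorics using (_C_; k![n∸k]!∣n!)
  open import Data.Nat.Combinatorics.Specification using (nCk≡n!/k![n-k]!; k>n⇒nCk≡0)
  open import Data.Nat.Tactic.RingSolver using (solve-∀)
  open import Relation.Binary.PropositionalEquality
  open import Relation.Nullary using (yes; no)

  -- The factorial quotient k!/a!, a natural number when a ≤ k; these are
  -- the coefficients of P:  p_{k,a+1} = (k!/a!)·φ_{k-a}.
  factQuot : ℕ → ℕ → ℕ
  factQuot k a = (k ! / a !) {{a !≢0}}

  factQuot-spec : ∀ {a k} → a ≤ k → factQuot k a * a ! ≡ k !
  factQuot-spec {a} {k} a≤k =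
    m/n*n≡m {{a !≢0}} (∣-trans (m∣m*n ((k ∸ a) !)) (k![n∸k]!∣n! a≤k))

  binomial-spec : ∀ {a n} → a ≤ n → (n C a) * (a ! * (n ∸ a) !) ≡ n !
  binomial-spec {a} {n} a≤n =
    trans (cong (_* (a ! * (n ∸ a) !)) (nCk≡n!/k![n-k]! a≤n))
          (m/n*n≡m {{a !* (n ∸ a) !≢0}} (k![n∸k]!∣n! a≤n))

  ∸-+-reorder : ∀ i a m → i ∸ (a + m) ≡ (i ∸ m) ∸ a
  ∸-+-reorder i a m = trans (cong (i ∸_) (+-comm a m)) (sym (∸-+-assoc i m a))

  -- binom(i, a+m)·(a+m)!/a! = i!/(i-m)!·binom(i-m, a): both sides count the
  -- ways to choose an a-subset and a disjoint ordered m-tuple in an i-set.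
  choose-falling : ∀ {m i} a → m ≤ i →
    (i C (a + m)) * factQuot (a + m) a ≡ factQuot i (i ∸ m) * ((i ∸ m) C a)
  choose-falling {m} {i} a m≤i with a ≤? i ∸ m
  ... | no a≰n = begin
    (i C (a + m)) * factQuot (a + m) a  ≡⟨ cong (_* factQuot (a + m) a) (k>n⇒nCk≡0 a+m>i) ⟩
    0                                   ≡⟨ *-zeroʳ (factQuot i (i ∸ m)) ⟨
    factQuot i (i ∸ m) * 0              ≡⟨ cong (factQuot i (i ∸ m) *_) (k>n⇒nCk≡0 (≰⇒> a≰n)) ⟨
    factQuot i (i ∸ m) * ((i ∸ m) C a)  ∎
    where
    open ≡-Reasoning
    a+m>i : i < a + m
    a+m>i = subst (_< a + m) (m∸n+n≡m m≤i) (+-monoˡ-< m (≰⇒> a≰n))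
  ... | yes a≤n = *-cancelʳ-≡ _ _ X {{m*n≢0 _ _ {{a !* (n ∸ a) !≢0}} {{n !≢0}}}}
                    (trans lhs-scaled (sym rhs-scaled))
    where
    open ≡-Reasoning
    n = i ∸ m
    k = a + m
    X = a ! * (n ∸ a) ! * n !
    k≤i : k ≤ i
    k≤i = subst (k ≤_) (m∸n+n≡m m≤i) (+-monoˡ-≤ m a≤n)
    lhs-scaled : (i C k) * factQuot k a * X ≡ i ! * n !
    lhs-scaled = begin
      (i C k) * factQuot k a * X                      ≡⟨ regroup (i C k) (factQuot k a) (a !) ((n ∸ a) !) (n !) ⟩
      (i C k) * (factQuot k a * a ! * (n ∸ a) !) * n ! ≡⟨ cong (λ z → (i C k) * (z * (n ∸ a) !) * n !) (factQuot-spec (m≤m+n a m)) ⟩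
      (i C k) * (k ! * (n ∸ a) !) * n !               ≡⟨ cong (λ z → (i C k) * (k ! * z !) * n !) (∸-+-reorder i a m) ⟨
      (i C k) * (k ! * (i ∸ k) !) * n !               ≡⟨ cong (_* n !) (binomial-spec k≤i) ⟩
      i ! * n !                                       ∎
      where
      regroup : ∀ c f x y z → c * f * (x * y * z) ≡ c * (f * x * y) * z
      regroup = solve-∀
    rhs-scaled : factQuot i n * (n C a) * X ≡ i ! * n !
    rhs-scaled = begin
      factQuot i n * (n C a) * X                          ≡⟨ regroup (factQuot i n) (n C a) (a !) ((n ∸ a) !) (n !) ⟩
      (factQuot i n * n !) * ((n C a) * (a ! * (n ∸ a) !)) ≡⟨ cong₂ _*_ (factQuot-spec (m∸n≤m i m)) (binomial-spec a≤n) ⟩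
      i ! * n !                                           ∎
      where
      regroup : ∀ c f x y z → c * f * (x * y * z) ≡ (c * z) * (f * (x * y))
      regroup = solve-∀

module RingFacts {c ℓ : Level} (R : CommutativeRing c ℓ) where
  open import Data.Nat as ℕ using (zero; suc; _≤_; _<_; _≤′_; ≤′-refl; ≤′-step)
  open import Data.Nat.Properties as ℕₚ using (≤⇒≤′; ≤′⇒≤)
  open import Data.Nat.Combinatorics using (_C_; nCk+nC[k+1]≡[n+1]C[k+1])
  open import Data.Nat.Combinatorics.Specification using (k>n⇒nCk≡0)
  open import Data.Bool using (true; false; T; if_then_else_)
  open import Data.Unit using (tt)
  open import Data.Empty using (⊥-elim)
  open import Data.Sum using (inj₁; inj₂)
  open import Relation.Nullary using (¬_; yes; no)
  open import Function using (_∘′_)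
  import Relation.Binary.PropositionalEquality as ≡
  open ≡ using (_≡_; _≢_)
  open CommutativeRing R
  open import Algebra.Properties.Semiring.Mult semiring
    using (_×_; ×-congʳ; ×-homo-+; ×-comm-*; ×-assoc-*; ×-assocˡ)
  open import Algebra.Properties.CommutativeSemigroup +-commutativeSemigroup
    using () renaming (interchange to +-interchange)
  open import Algebra.Properties.CommutativeSemigroup *-commutativeSemigroup
    using (x∙yz≈y∙xz)
  open import Relation.Binary.Reasoning.Setoid setoid
  open Mat R
  open FactorialIdentity using (factQuot; choose-falling; ∸-+-reorder)

  natMul≡× : ∀ n x → natMul n x ≡ n × x
  natMul≡× zero    x = ≡.refl
  natMul≡× (suc n) x = ≡.cong (x +_) (natMul≡× n x)

  ×-*-× : ∀ a b x z → (a × x) * (b × z) ≈ (a ℕ.* b) × (x * z)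
  ×-*-× a b x z = begin
    (a × x) * (b × z)   ≈⟨ ×-assoc-* a x (b × z) ⟩
    a × (x * (b × z))   ≈⟨ ×-congʳ a (×-comm-* b x z) ⟩
    a × (b × (x * z))   ≈⟨ ×-assocˡ (x * z) a b ⟩
    (a ℕ.* b) × (x * z) ∎

  sum-cong : ∀ N {f g} → (∀ k → k < N → f k ≈ g k) → sumTo N f ≈ sumTo N g
  sum-cong zero    f≈g = refl
  sum-cong (suc N) f≈g =
    +-cong (sum-cong N (λ k k<N → f≈g k (ℕₚ.m<n⇒m<1+n k<N))) (f≈g N (ℕₚ.n<1+n N))

  sum-zero : ∀ N {f} → (∀ k → k < N → f k ≈ 0#) → sumTo N f ≈ 0#
  sum-zero zero    f≈0 = refl
  sum-zero (suc N) f≈0 =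
    trans (+-cong (sum-zero N (λ k k<N → f≈0 k (ℕₚ.m<n⇒m<1+n k<N))) (f≈0 N (ℕₚ.n<1+n N)))
          (+-identityʳ 0#)

  sum-+ : ∀ N f g → sumTo N (λ k → f k + g k) ≈ sumTo N f + sumTo N g
  sum-+ zero    f g = sym (+-identityˡ 0#)
  sum-+ (suc N) f g = trans (+-congʳ (sum-+ N f g)) (+-interchange _ _ _ _)

  sum-*ˡ : ∀ N a f → a * sumTo N f ≈ sumTo N (λ k → a * f k)
  sum-*ˡ zero    a f = zeroʳ a
  sum-*ˡ (suc N) a f = trans (distribˡ a _ _) (+-congʳ (sum-*ˡ N a f))

  sum-*ʳ : ∀ N a f → sumTo N f * a ≈ sumTo N (λ k → f k * a)
  sum-*ʳ zero    a f = zeroˡ a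
  sum-*ʳ (suc N) a f = trans (distribʳ a _ _) (+-congʳ (sum-*ʳ N a f))

  sum-pad : ∀ {N M} f → N ≤ M → (∀ k → N ≤ k → f k ≈ 0#) → sumTo M f ≈ sumTo N f
  sum-pad {N} f N≤M f≈0 = go (≤⇒≤′ N≤M)
    where
    go : ∀ {M} → N ≤′ M → sumTo M f ≈ sumTo N f
    go ≤′-refl       = refl
    go (≤′-step N≤M) = trans (+-cong (go N≤M) (f≈0 _ (≤′⇒≤ N≤M))) (+-identityʳ _)

  sum-split : ∀ a N f → sumTo (a ℕ.+ N) f ≈ sumTo a f + sumTo N (λ m → f (a ℕ.+ m))
  sum-split a zero    f rewrite ℕₚ.+-identityʳ a = sym (+-identityʳ _)
  sum-split a (suc N) f rewrite ℕₚ.+-suc a N =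
    trans (+-congʳ (sum-split a N f)) (+-assoc _ _ _)

  sum-shift : ∀ a N f → (∀ k → k < a → f k ≈ 0#) → (∀ k → N ≤ k → f k ≈ 0#) →
              sumTo N f ≈ sumTo N (λ m → f (a ℕ.+ m))
  sum-shift a N f below above = begin
    sumTo N f                                 ≈⟨ sum-pad f (ℕₚ.m≤n+m N a) above ⟨
    sumTo (a ℕ.+ N) f                         ≈⟨ sum-split a N f ⟩
    sumTo a f + sumTo N (λ m → f (a ℕ.+ m))   ≈⟨ +-congʳ (sum-zero a below) ⟩
    0# + sumTo N (λ m → f (a ℕ.+ m))          ≈⟨ +-identityˡ _ ⟩
    sumTo N (λ m → f (a ℕ.+ m))               ∎

  sum-front : ∀ N f → sumTo (suc N) f ≈ f 0 + sumTo N (λ k → f (suc k))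
  sum-front zero    f = +-comm _ _
  sum-front (suc N) f = trans (+-congʳ (sum-front N f)) (+-assoc _ _ _)

  sum-reverse : ∀ i f → sumTo (suc i) f ≈ sumTo (suc i) (λ m → f (i ℕ.∸ m))
  sum-reverse zero    f = refl
  sum-reverse (suc i) f = begin
    sumTo (suc i) f + f (suc i)                   ≈⟨ +-congʳ (sum-reverse i f) ⟩
    sumTo (suc i) (λ m → f (i ℕ.∸ m)) + f (suc i) ≈⟨ +-comm _ _ ⟩
    f (suc i) + sumTo (suc i) (λ m → f (i ℕ.∸ m)) ≈⟨ sum-front (suc i) (λ m → f (suc i ℕ.∸ m)) ⟨
    sumTo (suc (suc i)) (λ m → f (suc i ℕ.∸ m))   ∎

  sum-swap : ∀ N M (h : ℕ → ℕ → Carrier) →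
    sumTo N (λ k → sumTo M (h k)) ≈ sumTo M (λ m → sumTo N (λ k → h k m))
  sum-swap zero    M h = sym (sum-zero M (λ _ _ → refl))
  sum-swap (suc N) M h = trans (+-congʳ (sum-swap N M h)) (sym (sum-+ M _ _))

  if-T : ∀ {b} {x z : Carrier} → T b → (if b then x else z) ≡ x
  if-T {true} _ = ≡.refl

  if-¬T : ∀ {b} {x z : Carrier} → ¬ T b → (if b then x else z) ≡ z
  if-¬T {false} _  = ≡.refl
  if-¬T {true}  ¬t = ⊥-elim (¬t tt)

  δ-diag : ∀ i → δ i i ≈ 1#
  δ-diag i = reflexive (if-T (ℕₚ.≡⇒≡ᵇ i i ≡.refl))

  δ-off : ∀ i j → i ≢ j → δ i j ≈ 0#
  δ-off i j i≢j = reflexive (if-¬T (λ t → i≢j (ℕₚ.≡ᵇ⇒≡ i j t)))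

  δ-sym : ∀ i j → δ i j ≈ δ j i
  δ-sym i j with i ℕₚ.≟ j
  ... | yes ≡.refl = refl
  ... | no  i≢j    = trans (δ-off i j i≢j) (sym (δ-off j i (i≢j ∘′ ≡.sym)))

  By-entry : ∀ y n k → By y n k ≈ (n C k) × pow y (n ℕ.∸ k)
  By-entry y n k = reflexive (natMul≡× (n C k) (pow y (n ℕ.∸ k)))

  By-lower : ∀ y → LowerTriangular (By y)
  By-lower y n k n<k = reflexive (≡.cong (λ b → natMul b (pow y (n ℕ.∸ k))) (k>n⇒nCk≡0 n<k))

  Pm-above : ∀ φ k a → k < a → Pm φ k (suc a) ≈ 0#
  Pm-above φ k a k<a = reflexive (if-T (ℕₚ.<⇒<ᵇ k<a))

  Pm-entry : ∀ φ k a → a ≤ k → Pm φ k (suc a) ≈ factQuot k a × φ (k ℕ.∸ a)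
  Pm-entry φ k a a≤k = begin
    Pm φ k (suc a)                            ≡⟨ if-¬T (λ t → ℕₚ.≤⇒≯ a≤k (ℕₚ.<ᵇ⇒< k a t)) ⟩
    natMul (factQuot k a) (φ (k ℕ.∸ a))       ≡⟨ natMul≡× (factQuot k a) (φ (k ℕ.∸ a)) ⟩
    factQuot k a × φ (k ℕ.∸ a)                ∎

  Pm-beyond : ∀ φ k l → suc (suc k) ≤ l → Pm φ k l ≈ 0#
  Pm-beyond φ k (suc a) (ℕ.s≤s k<a) = Pm-above φ k a k<a

  sum-δ-outside : ∀ N j (f : ℕ → Carrier) → N ≤ j → sumTo N (λ l → f l * δ l j) ≈ 0#
  sum-δ-outside N j f N≤j = sum-zero N (λ l l<N →
    trans (*-congˡ (δ-off l j (ℕₚ.<⇒≢ (ℕₚ.<-≤-trans l<N N≤j)))) (zeroʳ _))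

  sum-δ-inside : ∀ N j (f : ℕ → Carrier) → j < N → sumTo N (λ l → f l * δ l j) ≈ f j
  sum-δ-inside (suc N) j f j<1+N with ℕₚ.m<1+n⇒m<n∨m≡n j<1+N
  ... | inj₁ j<N = begin
    sumTo N (λ l → f l * δ l j) + f N * δ N j
      ≈⟨ +-cong (sum-δ-inside N j f j<N) (trans (*-congˡ (δ-off N j (ℕₚ.>⇒≢ j<N))) (zeroʳ _)) ⟩
    f j + 0#  ≈⟨ +-identityʳ _ ⟩
    f j       ∎
  ... | inj₂ ≡.refl = begin
    sumTo N (λ l → f l * δ l N) + f N * δ N N
      ≈⟨ +-cong (sum-δ-outside N N f ℕₚ.≤-refl) (trans (*-congˡ (δ-diag N)) (*-identityʳ _)) ⟩
    0# + f N  ≈⟨ +-identityˡ _ ⟩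
    f N       ∎

  sum-δ : ∀ N j (f : ℕ → Carrier) → (∀ l → N ≤ l → f l ≈ 0#) → sumTo N (λ l → f l * δ l j) ≈ f j
  sum-δ N j f f≈0 with j ℕₚ.<? N
  ... | yes j<N = sum-δ-inside N j f j<N
  ... | no  j≮N = trans (sum-δ-outside N j f (ℕₚ.≮⇒≥ j≮N)) (sym (f≈0 j (ℕₚ.≮⇒≥ j≮N)))

  ·P-I+yΔᵀ : ∀ y (A : Matrix) → (∀ k l → suc (suc k) ≤ l → A k l ≈ 0#) →
    ∀ k j → (A ·P (I +M scale y (transpose Δ))) k j ≈ A k j + y * A k (suc j)
  ·P-I+yΔᵀ y A A-band k j = begin
    sumTo M (λ l → A k l * (δ l j + y * δ (suc j) l))
      ≈⟨ sum-cong M (λ l _ → trans (distribˡ _ _ _) (+-congˡ (move l))) ⟩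
    sumTo M (λ l → A k l * δ l j + (y * A k l) * δ l (suc j))
      ≈⟨ sum-+ M _ _ ⟩
    sumTo M (λ l → A k l * δ l j) + sumTo M (λ l → (y * A k l) * δ l (suc j))
      ≈⟨ +-cong (sum-δ M j (A k) (A-band k))
                (sum-δ M (suc j) (λ l → y * A k l) (λ l M≤l → trans (*-congˡ (A-band k l M≤l)) (zeroʳ y))) ⟩
    A k j + y * A k (suc j) ∎
    where
    M = suc (suc k)
    move : ∀ l → A k l * (y * δ (suc j) l) ≈ (y * A k l) * δ l (suc j)
    move l = trans (sym (*-assoc _ _ _)) (*-cong (*-comm _ _) (δ-sym (suc j) l))

  ·L-congʳ : ∀ A {M M′} → M ≈M M′ → (A ·L M) ≈M (A ·L M′)
  ·L-congʳ A M≈M′ i j = sum-cong (suc i) (λ k _ → *-congˡ (M≈M′ k j))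

  -- If A·B = I with B lower triangular then A·(B·M) = M.  The truncated
  -- products reassociate because row k of B vanishes beyond column k.
  cancel-left : ∀ {A B} → LowerTriangular B → (A ·L B) ≈M I → ∀ M → (A ·L (B ·L M)) ≈M M
  cancel-left {A} {B} B-lower AB≈I M i j = begin
    sumTo (suc i) (λ k → A i k * sumTo (suc k) (λ m → B k m * M m j))
      ≈⟨ sum-cong (suc i) (λ k k≤i → *-congˡ (sym (sum-pad (λ m → B k m * M m j) k≤i
           (λ m k<m → trans (*-congʳ (B-lower k m k<m)) (zeroˡ _))))) ⟩
    sumTo (suc i) (λ k → A i k * sumTo (suc i) (λ m → B k m * M m j))
      ≈⟨ sum-cong (suc i) (λ k _ → sum-*ˡ (suc i) (A i k) _) ⟩
    sumTo (suc i) (λ k → sumTo (suc i) (λ m → A i k * (B k m * M m j)))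
      ≈⟨ sum-swap (suc i) (suc i) _ ⟩
    sumTo (suc i) (λ m → sumTo (suc i) (λ k → A i k * (B k m * M m j)))
      ≈⟨ sum-cong (suc i) (λ m _ → trans (sum-cong (suc i) (λ k _ → sym (*-assoc _ _ _)))
                                         (sym (sum-*ʳ (suc i) (M m j) _))) ⟩
    sumTo (suc i) (λ m → (A ·L B) i m * M m j)
      ≈⟨ sum-cong (suc i) (λ m _ → trans (*-congʳ (AB≈I i m)) (trans (*-comm _ _) (*-congˡ (δ-sym i m)))) ⟩
    sumTo (suc i) (λ m → M m j * δ m i)
      ≈⟨ sum-δ-inside (suc i) i (λ m → M m j) (ℕₚ.n<1+n i) ⟩
    M i j ∎

  module Intertwining (φ : ℕ → Carrier) (y : Carrier) where

    Q : Matrix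
    Q = Pm φ ·P (I +M scale y (transpose Δ))

    term : ℕ → ℕ → ℕ → Carrier → Carrier
    term c n a x = (c ℕ.* (n C a)) × (x * pow y (n ℕ.∸ a))

    -- Pascal's rule for binomial terms.  The second summand is rewritten
    -- with one more power of y taken out, which is vacuous when a ≥ n
    -- since then binom(n,a+1) = 0.
    term-pascal : ∀ c n a x → term c (suc n) (suc a) x ≈ term c n a x + y * term c n (suc a) x
    term-pascal c n a x = begin
      (c ℕ.* (suc n C suc a)) × X
        ≡⟨ ≡.cong (_× X) (≡.trans (≡.cong (c ℕ.*_) (≡.sym (nCk+nC[k+1]≡[n+1]C[k+1] n a)))
                                   (ℕₚ.*-distribˡ-+ c (n C a) (n C suc a))) ⟩
      (c ℕ.* (n C a) ℕ.+ c ℕ.* (n C suc a)) × X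
        ≈⟨ ×-homo-+ X (c ℕ.* (n C a)) (c ℕ.* (n C suc a)) ⟩
      term c n a x + (c ℕ.* (n C suc a)) × X
        ≈⟨ +-congˡ lower-power ⟩
      term c n a x + y * term c n (suc a) x ∎
      where
      X = x * pow y (n ℕ.∸ a)
      lower-power : (c ℕ.* (n C suc a)) × X ≈ y * term c n (suc a) x
      lower-power with a ℕₚ.<? n
      ... | yes a<n = begin
        (c ℕ.* (n C suc a)) × (x * pow y (n ℕ.∸ a))
          ≡⟨ ≡.cong (λ e → (c ℕ.* (n C suc a)) × (x * pow y e)) (ℕₚ.+-∸-assoc 1 a<n) ⟩
        (c ℕ.* (n C suc a)) × (x * (y * pow y (n ℕ.∸ suc a)))
          ≈⟨ ×-congʳ (c ℕ.* (n C suc a)) (x∙yz≈y∙xz x y _) ⟩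
        (c ℕ.* (n C suc a)) × (y * (x * pow y (n ℕ.∸ suc a)))
          ≈⟨ ×-comm-* (c ℕ.* (n C suc a)) y _ ⟨
        y * term c n (suc a) x ∎
      ... | no a≮n = begin
        (c ℕ.* (n C suc a)) × X           ≡⟨ ≡.cong (_× X) no-term ⟩
        0#                                ≈⟨ zeroʳ y ⟨
        y * 0#                            ≡⟨ ≡.cong (λ b → y * (b × (x * pow y (n ℕ.∸ suc a)))) no-term ⟨
        y * term c n (suc a) x            ∎
        where
        no-term : c ℕ.* (n C suc a) ≡ 0
        no-term = ≡.trans (≡.cong (c ℕ.*_) (k>n⇒nCk≡0 (ℕ.s≤s (ℕₚ.≮⇒≥ a≮n)))) (ℕₚ.*-zeroʳ c)

    -- Column 0 of Pascal's rule: binom(n+1,0) = binom(n,0) = 1.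
    term-col0 : ∀ c n x → term c (suc n) 0 x ≈ y * term c n 0 x
    term-col0 c n x = begin
      (c ℕ.* 1) × (x * (y * pow y n))   ≈⟨ ×-congʳ (c ℕ.* 1) (x∙yz≈y∙xz x y _) ⟩
      (c ℕ.* 1) × (y * (x * pow y n))   ≈⟨ ×-comm-* (c ℕ.* 1) y _ ⟨
      y * term c n 0 x                  ∎

    -- The m-th summands of (P·B)_{ij} and (B·P)_{i,a+1}, where n = i - m.
    pbTerm : ℕ → ℕ → ℕ → Carrier
    pbTerm i j m = term (factQuot i (i ℕ.∸ m)) (suc (i ℕ.∸ m)) j (φ m)

    bpTerm : ℕ → ℕ → ℕ → Carrier
    bpTerm i a m = term (factQuot i (i ℕ.∸ m)) (i ℕ.∸ m) a (φ m)

    PB-summand : ∀ i j k → k ≤ i →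
      Pm φ i (suc k) * By y (suc k) j ≈ term (factQuot i k) (suc k) j (φ (i ℕ.∸ k))
    PB-summand i j k k≤i =
      trans (*-cong (Pm-entry φ i k k≤i) (By-entry y (suc k) j))
            (×-*-× (factQuot i k) (suc k C j) _ _)

    PB-entry : ∀ i j → (Pm φ ·P By y) i j ≈ sumTo (suc i) (pbTerm i j)
    PB-entry i j = begin
      sumTo (suc (suc i)) (λ k → Pm φ i k * By y k j)
        ≈⟨ sum-front (suc i) _ ⟩
      0# * By y 0 j + sumTo (suc i) (λ k → Pm φ i (suc k) * By y (suc k) j)
        ≈⟨ +-cong (zeroˡ _) (sum-cong (suc i) (λ k k<1+i → PB-summand i j k (ℕ.s≤s⁻¹ k<1+i))) ⟩
      0# + sumTo (suc i) (λ k → term (factQuot i k) (suc k) j (φ (i ℕ.∸ k)))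
        ≈⟨ +-identityˡ _ ⟩
      sumTo (suc i) (λ k → term (factQuot i k) (suc k) j (φ (i ℕ.∸ k)))
        ≈⟨ sum-reverse i _ ⟩
      sumTo (suc i) (λ m → term (factQuot i (i ℕ.∸ m)) (suc (i ℕ.∸ m)) j (φ (i ℕ.∸ (i ℕ.∸ m))))
        ≈⟨ sum-cong (suc i) (λ m m<1+i →
             reflexive (≡.cong (λ l → term (factQuot i (i ℕ.∸ m)) (suc (i ℕ.∸ m)) j (φ l)) (ℕₚ.m∸[m∸n]≡n (ℕ.s≤s⁻¹ m<1+i)))) ⟩
      sumTo (suc i) (pbTerm i j) ∎

    BP-summand : ∀ i a m → m ≤ i → By y i (a ℕ.+ m) * Pm φ (a ℕ.+ m) (suc a) ≈ bpTerm i a m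
    BP-summand i a m m≤i = begin
      By y i k * Pm φ k (suc a)
        ≈⟨ *-cong (By-entry y i k) (Pm-entry φ k a (ℕₚ.m≤m+n a m)) ⟩
      ((i C k) × pow y (i ℕ.∸ k)) * (factQuot k a × φ (k ℕ.∸ a))
        ≈⟨ ×-*-× (i C k) (factQuot k a) _ _ ⟩
      ((i C k) ℕ.* factQuot k a) × (pow y (i ℕ.∸ k) * φ (k ℕ.∸ a))
        ≡⟨ ≡.cong₂ _×_ (choose-falling a m≤i)
                       (≡.cong₂ (λ e l → pow y e * φ l) (∸-+-reorder i a m) (ℕₚ.m+n∸m≡n a m)) ⟩
      (factQuot i n ℕ.* (n C a)) × (pow y (n ℕ.∸ a) * φ m)
        ≈⟨ ×-congʳ (factQuot i n ℕ.* (n C a)) (*-comm _ _) ⟩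
      bpTerm i a m ∎
      where
      k = a ℕ.+ m
      n = i ℕ.∸ m

    -- (B·P)_{i,a+1}: only k = a + m with m ≤ i contribute.
    BP-entry : ∀ i a → (By y ·L Pm φ) i (suc a) ≈ sumTo (suc i) (bpTerm i a)
    BP-entry i a = begin
      sumTo (suc i) (λ k → By y i k * Pm φ k (suc a))
        ≈⟨ sum-shift a (suc i) _ (λ k k<a → trans (*-congˡ (Pm-above φ k a k<a)) (zeroʳ _))
                                 (λ k i<k → trans (*-congʳ (By-lower y i k i<k)) (zeroˡ _)) ⟩
      sumTo (suc i) (λ m → By y i (a ℕ.+ m) * Pm φ (a ℕ.+ m) (suc a))
        ≈⟨ sum-cong (suc i) (λ m m<1+i → BP-summand i a m (ℕ.s≤s⁻¹ m<1+i)) ⟩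
      sumTo (suc i) (bpTerm i a) ∎

    BP-col0 : ∀ i → (By y ·L Pm φ) i 0 ≈ 0#
    BP-col0 i = sum-zero (suc i) (λ k _ → zeroʳ _)

    BQ-entry : ∀ i j → (By y ·L Q) i j ≈ (By y ·L Pm φ) i j + y * (By y ·L Pm φ) i (suc j)
    BQ-entry i j = begin
      sumTo (suc i) (λ k → By y i k * Q k j)
        ≈⟨ sum-cong (suc i) (λ k _ → trans (*-congˡ (·P-I+yΔᵀ y (Pm φ) (Pm-beyond φ) k j))
                                      (trans (distribˡ _ _ _) (+-congˡ (x∙yz≈y∙xz _ y _)))) ⟩
      sumTo (suc i) (λ k → By y i k * Pm φ k j + y * (By y i k * Pm φ k (suc j)))
        ≈⟨ sum-+ (suc i) _ _ ⟩
      (By y ·L Pm φ) i j + sumTo (suc i) (λ k → y * (By y i k * Pm φ k (suc j)))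
        ≈⟨ +-congˡ (sum-*ˡ (suc i) y _) ⟨
      (By y ·L Pm φ) i j + y * (By y ·L Pm φ) i (suc j) ∎

    intertwine : (Pm φ ·P By y) ≈M (By y ·L Q)
    intertwine i zero = begin
      (Pm φ ·P By y) i 0                              ≈⟨ PB-entry i 0 ⟩
      sumTo (suc i) (pbTerm i 0)                      ≈⟨ sum-cong (suc i) (λ m _ → term-col0 (factQuot i (i ℕ.∸ m)) (i ℕ.∸ m) (φ m)) ⟩
      sumTo (suc i) (λ m → y * bpTerm i 0 m)          ≈⟨ sum-*ˡ (suc i) y _ ⟨
      y * sumTo (suc i) (bpTerm i 0)                  ≈⟨ *-congˡ (BP-entry i 0) ⟨
      y * (By y ·L Pm φ) i 1                          ≈⟨ +-identityˡ _ ⟨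
      0# + y * (By y ·L Pm φ) i 1                     ≈⟨ +-congʳ (BP-col0 i) ⟨
      (By y ·L Pm φ) i 0 + y * (By y ·L Pm φ) i 1     ≈⟨ BQ-entry i 0 ⟨
      (By y ·L Q) i 0                                 ∎
    intertwine i (suc a) = begin
      (Pm φ ·P By y) i (suc a)
        ≈⟨ PB-entry i (suc a) ⟩
      sumTo (suc i) (pbTerm i (suc a))
        ≈⟨ sum-cong (suc i) (λ m _ → term-pascal (factQuot i (i ℕ.∸ m)) (i ℕ.∸ m) a (φ m)) ⟩
      sumTo (suc i) (λ m → bpTerm i a m + y * bpTerm i (suc a) m)
        ≈⟨ sum-+ (suc i) _ _ ⟩
      sumTo (suc i) (bpTerm i a) + sumTo (suc i) (λ m → y * bpTerm i (suc a) m)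
        ≈⟨ +-congˡ (sum-*ˡ (suc i) y _) ⟨
      sumTo (suc i) (bpTerm i a) + y * sumTo (suc i) (bpTerm i (suc a))
        ≈⟨ +-cong (BP-entry i a) (*-congˡ (BP-entry i (suc a))) ⟨
      (By y ·L Pm φ) i (suc a) + y * (By y ·L Pm φ) i (suc (suc a))
        ≈⟨ BQ-entry i (suc a) ⟨
      (By y ·L Q) i (suc a) ∎

-- Multiply the intertwining relation P·B = B·Q on the left by Binv; only the
-- left-inverse hypothesis is needed.
lemma3p6 : ∀ {c ℓ : Level} (R : CommutativeRing c ℓ) →
    let open CommutativeRing R using (Carrier) in
    let open Mat R in
    (φ : ℕ → Carrier) (y : Carrier) (Binv : Matrix) →
    LowerTriangular Binv →
    (Binv ·L By y) ≈M I →
    (By y ·L Binv) ≈M I →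
    (Binv ·L (Pm φ ·P By y)) ≈M (Pm φ ·P (I +M scale y (transpose Δ)))
lemma3p6 R φ y Binv _ Binv·B≈I _ i j =
  trans (·L-congʳ Binv intertwine i j) (cancel-left (By-lower y) Binv·B≈I Q i j)
  where
  open CommutativeRing R using (trans)
  open RingFacts R
  open Intertwining φ y
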